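{- Let $G$ be a graph and $k$ a non-negative integer. If $\mathcal{D}$ is a $k$-tight tree-partition of $G$ with a $k$-splittable torso, then there is a $k$-tight tree-partition $\mathcal{D}'$ of $G$ with ${\bf w}(\mathcal{D}')<{\bf w}(\mathcal{D})$.
   Context: Graphs are finite, undirected, loopless, possibly with parallel edges; degrees count edges with multiplicity and $\Delta(H)$ is the maximum degree of $H$. A tree-partition of $G$ is a pair $\mathcal{D}=(T,\mathcal{B})$ with $T$ a tree and $\mathcal{B}=\{B_t\mid t\in V(T)\}$ pairwise disjoint (possibly empty) sets with union $V(G)$. For $e\in E(T)$, with $T_1,T_2$ the components of $T\setminus e$ and $V_i=\bigcup_{t\in V(T_i)}B_t$, ${\bf cross}_{\mathcal{D}}(e)$ is the multiset of edges of $G$ between $V_1$ and $V_2$; the adhesion of $\mathcal{D}$ is $\max_{e}|{\bf cross}_{\mathcal{D}}(e)|$. For $t\in V(T)$, with $T_1,\dots,T_q$ the components of $T\setminus t$ and $\bar B_i=\bigcup_{h\in V(T_i)}B_h$, the $t$-torso $Z_t$ is obtained from $G$ by identifying all vertices of each $\bar B_i$ into a new vertex $z_i$ (keeping parallel edges, discarding loops). The strength of $\mathcal{D}$ is $\min_{t\in V(T)}\Delta(Z_t)$. $\mathcal{D}$ is $k$-tight if its adhesion is at most $k$ and its strength is at least $k+1$. A torso $Z_t$ is $k$-splittable if it has a bipartition $(X,\overline X)$ of $V(Z_t)$ with at most $k$ edges between $X$ and $\overline X$ such that both $X$ and $\overline X$ contain a vertex of degree at least $k+1$ in $Z_t$.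 ${\bf w}(\mathcal{D})=\sum_{t\in V(T)}({\bf s}_{\mathcal{D}}(t)-1)$, where ${\bf s}_{\mathcal{D}}(t)$ is the number of vertices of $B_t$ of degree at least $k+1$ in $G$. -}

module Defs where

open import Data.Nat using (ℕ; zero; suc; _+_; _≤_; _⊔_; _<ᵇ_)
open import Data.Integer as ℤ using (ℤ)
open import Data.Bool using (Bool; true; false; _∧_; _∨_; not; if_then_else_; _xor_)
open import Data.Fin as Fin using (Fin; _≟_; _↑ˡ_; _↑ʳ_; splitAt)
open import Data.List using (List; []; _∷_; length; lookup; removeAt; filterᵇ; map; allFin; findᵇ; foldr)
open import Data.List.Relation.Unary.All using (All)
open import Data.Maybe using (Maybe; just; nothing)
open import Data.Product using (Σ; _×_; _,_; proj₁; proj₂; ∃)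
open import Data.Sum using (inj₁; inj₂)
open import Relation.Nullary using (does; ¬_)
open import Relation.Binary.PropositionalEquality using (_≡_; _≢_)

_==_ : ∀ {n} → Fin n → Fin n → Bool
a == b = does (a ≟ b)

countᵇ : ∀ {A : Set} → (A → Bool) → List A → ℕ
countᵇ p []       = 0
countᵇ p (x ∷ xs) = if p x then suc (countᵇ p xs) else countᵇ p xs

maxOver : ∀ {A : Set} → (A → ℕ) → List A → ℕ
maxOver f = foldr (λ x r → f x ⊔ r) 0

sumFinℤ : (m : ℕ) → (Fin m → ℤ) → ℤ
sumFinℤ m f = foldr (λ i r → f i ℤ.+ r) (ℤ.+ 0) (allFin m)

-- Multigraphs.  A multigraph has vertex set {x : Fin size | isV x ≡ true}
-- and a list of edges (a list, so parallel edges are allowed).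

record MGraph : Set where
  field
    size  : ℕ
    isV   : Fin size → Bool
    edges : List (Fin size × Fin size)

module _ (H : MGraph) where
  open MGraph H

  -- degree, counted with multiplicity (loops would count once; all graphs
  -- considered here are loopless)
  deg : Fin size → ℕ
  deg x = countᵇ (λ e → (proj₁ e == x) ∨ (proj₂ e == x)) edges

  Δ : ℕ
  Δ = maxOver deg (filterᵇ isV (allFin size))

  cutSize : (Fin size → Bool) → ℕ
  cutSize X = countᵇ (λ e → X (proj₁ e) xor X (proj₂ e)) edges

Loopless : ∀ {n} → List (Fin n × Fin n) → Set
Loopless E = All (λ e → proj₁ e ≢ proj₂ e) E

asMGraph : (n : ℕ) → List (Fin n × Fin n) → MGraph
asMGraph n E = record { size = n ; isV = λ _ → true ; edges = E }

-- Reachability in a graph on Fin m given by an edge list: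
-- y is reachable from s iff there is a walk of length < m, computed by
-- iterating the "add all neighbours" step m times from {s}.

step : ∀ {m} → List (Fin m × Fin m) → (Fin m → Bool) → (Fin m → Bool)
step E R x = R x ∨ foldr (λ e r → ((proj₁ e == x) ∧ R (proj₂ e))
                                 ∨ ((proj₂ e == x) ∧ R (proj₁ e)) ∨ r) false E

iter : ∀ {m} → List (Fin m × Fin m) → ℕ → (Fin m → Bool) → (Fin m → Bool)
iter E zero    R = R
iter E (suc j) R = step E (iter E j R)

reach : ∀ {m} → List (Fin m × Fin m) → Fin m → Fin m → Bool
reach {m} E s = iter E m (λ x → s == x)

record IsTree (m : ℕ) (E : List (Fin m × Fin m)) : Set where
  field
    nonempty  : 1 ≤ m
    loopless  : Loopless E
    connected : ∀ x y → reach E x y ≡ true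
    edgeCount : length E + 1 ≡ m

-- Tree-partitions of a graph with vertex set Fin n.  The bags are
-- B_t = {v | bag v ≡ t}; they are pairwise disjoint, possibly empty,
-- and cover V(G).

record TreePartition (n : ℕ) : Set where
  field
    m      : ℕ
    tedges : List (Fin m × Fin m)
    isTree : IsTree m tedges
    bag    : Fin n → Fin m

module _ {n : ℕ} (EG : List (Fin n × Fin n)) (D : TreePartition n) where
  open TreePartition D

  -- cross_D(e) for the tree edge with index i: edges of G between the two
  -- sides V_1, V_2 of T \ e (side of a node = reachable from the first
  -- endpoint of e in T \ e)
  cross : Fin (length tedges) → ℕ
  cross i = countᵇ (λ e → side (bag (proj₁ e)) xor side (bag (proj₂ e))) EG
    where
      side : Fin m → Bool
      side = reach (removeAt tedges i) (proj₁ (lookup tedges i))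

  AdhesionAtMost : ℕ → Set
  AdhesionAtMost k = ∀ i → cross i ≤ k

  adjT : Fin m → Fin m → Bool
  adjT t s = foldr (λ e r → ((proj₁ e == t) ∧ (proj₂ e == s))
                          ∨ ((proj₂ e == t) ∧ (proj₁ e == s)) ∨ r) false tedges

  -- Vertex set: Fin (n + m), where v ↑ˡ m (v ∈ Fin n)
  -- is the vertex v itself, present iff v ∈ B_t, and n ↑ʳ s is the
  -- identified vertex z_s of the component of T \ t containing the
  -- neighbour s of t, present iff s is adjacent to t.
  module _ (t : Fin m) where
    edgesMinus : List (Fin m × Fin m)
    edgesMinus = filterᵇ (λ e → not ((proj₁ e == t) ∨ (proj₂ e == t))) tedges

    compOf : Fin m → Maybe (Fin m)
    compOf h = findᵇ (λ s → adjT t s ∧ reach edgesMinus s h) (allFin m)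

    π : Fin n → Maybe (Fin (n + m))
    π v with bag v == t
    ... | true  = just (v ↑ˡ m)
    ... | false with compOf (bag v)
    ...   | just s  = just (n ↑ʳ s)
    ...   | nothing = nothing

    torsoV : Fin (n + m) → Bool
    torsoV x with splitAt n x
    ... | inj₁ v = bag v == t
    ... | inj₂ s = adjT t s

    torsoEdges : List (Fin n × Fin n) → List (Fin (n + m) × Fin (n + m))
    torsoEdges [] = []
    torsoEdges (e ∷ es) with π (proj₁ e) | π (proj₂ e)
    ... | just a | just b = if a == b then torsoEdges es else (a , b) ∷ torsoEdges es
    ... | _      | _      = torsoEdges es

    torso : MGraph
    torso = record { size = n + m ; isV = torsoV ; edges = torsoEdges EG }

  StrengthAtLeast : ℕ → Set
  StrengthAtLeast r = ∀ t → r ≤ Δ (torso t)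

  Tight : ℕ → Set
  Tight k = AdhesionAtMost k × StrengthAtLeast (suc k)

  sD : ℕ → Fin m → ℕ
  sD k t = countᵇ (λ v → (bag v == t) ∧ (k <ᵇ deg (asMGraph n EG) v)) (allFin n)

  w : ℕ → ℤ
  w k = sumFinℤ m (λ t → ℤ.+ (sD k t) ℤ.- ℤ.+ 1)

Splittable : ℕ → MGraph → Set
Splittable k H =
  Σ (Fin size → Bool) λ X →
    (cutSize H X ≤ k)
    × (∃ λ x → isV x ≡ true × X x ≡ true  × suc k ≤ deg H x)
    × (∃ λ y → isV y ≡ true × X y ≡ false × suc k ≤ deg H y)
  where open MGraph H

-- Let (X, X̄) be a cut of the torso Z_t with at most k crossing edges and a vertex of
-- degree > k on each side.  Replace the node t by two adjacent nodes, one for each side,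
-- sending every vertex of B_t and every branch of T − t to the side of the cut its torso
-- vertex lies on.  The new tree edge then separates exactly the edges of G crossing the
-- cut, and every old tree edge separates the same edges as before, so the adhesion stays
-- at most k.  The torso at the X-node is Z_t with X̄ contracted to a single vertex, so the
-- heavy vertex of X keeps its degree there, and symmetrically for X̄; every other torso
-- is unchanged up to renaming.  Finally w(D) = #{v : deg v > k} − |V(T)|, so adding a
-- node decreases w.

module Submission where

open import Defs
open import Data.Nat using (ℕ)
open import Data.Integer using (_<_)
open import Data.Fin using (Fin)
open import Data.List using (List)
open import Data.Product using (Σ; _×_; ∃)

import Data.Nat.Properties as ℕP
open import Algebra.Properties.CommutativeMonoid.Sum ℕP.+-0-commutativeMonoid
  using (sum; ∑-distrib-+; sum-cong-≗; sum-replicate-zero)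
open import Data.Bool as Bool using (Bool; true; false; _∧_; _∨_; not; if_then_else_; _xor_)
open import Data.Bool.Properties using (xor-same; ∧-identityʳ; ∧-zeroʳ; ¬-not; not-injective)
open import Data.Empty using (⊥-elim)
open import Data.Fin using (zero; suc; _↑ˡ_; _↑ʳ_; splitAt; _≟_)
import Data.Fin.Properties as FinP
import Data.Integer as ℤ
import Data.Integer.Properties as ℤP
open import Data.Integer.Solver using (module +-*-Solver)
open import Data.List using ([]; _∷_; length; lookup; removeAt; filterᵇ; findᵇ; map; allFin; foldr; tabulate)
open import Data.List.Properties using (length-tabulate; length-removeAt′; length-map)
open import Data.List.Membership.Propositional using (_∈_)
open import Data.List.Membership.Propositional.Properties using (∈-allFin)
open import Data.List.Relation.Unary.All using (_∷_)
import Data.List.Relation.Unary.All as All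
import Data.List.Relation.Unary.All.Properties as AllP
open import Data.List.Relation.Unary.Any as Any using (Any; here; there)
import Data.List.Relation.Unary.Any.Properties as AnyP
open import Data.Maybe using (Maybe; just; nothing)
open import Data.Nat as ℕ using (zero; suc; _≤_; z≤n; s≤s)
open import Data.Product using (_,_; proj₁; proj₂)
open import Data.Sum using (_⊎_; inj₁; inj₂)
open import Function using (_∘_)
open import Relation.Binary.Construct.Closure.ReflexiveTransitive as Star using (Star; ε; _◅_; _◅◅_)
open import Relation.Binary.PropositionalEquality
open import Relation.Nullary using (yes; no; does; ¬_)
open import Relation.Nullary.Decidable using (dec-true; dec-false; toSum)

==-refl : ∀ {n} (a : Fin n) → (a == a) ≡ true
==-refl a = dec-true (a ≟ a) refl

≢⇒==-false : ∀ {n} {a b : Fin n} → a ≢ b → (a == b) ≡ false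
≢⇒==-false {a = a} {b} = dec-false (a ≟ b)

==⇒≡ : ∀ {n} {a b : Fin n} → (a == b) ≡ true → a ≡ b
==⇒≡ {a = a} {b} _ with a ≟ b
==⇒≡ _  | yes a≡b = a≡b
==⇒≡ () | no _

==-false⇒≢ : ∀ {n} {a b : Fin n} → (a == b) ≡ false → a ≢ b
==-false⇒≢ {a = a} eq refl with () ← trans (sym (==-refl a)) eq

≡⇒== : ∀ {n} {a b : Fin n} → a ≡ b → (a == b) ≡ true
≡⇒== {a = a} refl = ==-refl a

∨-true⁻ : ∀ {x y} → (x ∨ y) ≡ true → x ≡ true ⊎ y ≡ true
∨-true⁻ {true}  _ = inj₁ refl
∨-true⁻ {false} e = inj₂ e

∧-true⁻ : ∀ {x y} → (x ∧ y) ≡ true → x ≡ true × y ≡ true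
∧-true⁻ {true} {true} _ = refl , refl

∨-trueˡ : ∀ {x} y → x ≡ true → (x ∨ y) ≡ true
∨-trueˡ _ refl = refl

∨-trueʳ : ∀ x {y} → y ≡ true → (x ∨ y) ≡ true
∨-trueʳ true  _ = refl
∨-trueʳ false e = e

∧-true⁺ : ∀ {x y} → x ≡ true → y ≡ true → (x ∧ y) ≡ true
∧-true⁺ refl refl = refl

true⇔⇒≡ : ∀ {x y} → (x ≡ true → y ≡ true) → (y ≡ true → x ≡ true) → x ≡ y
true⇔⇒≡ {true}  {true}  _ _ = refl
true⇔⇒≡ {true}  {false} f _ = sym (f refl)
true⇔⇒≡ {false} {true}  _ g = g refl
true⇔⇒≡ {false} {false} _ _ = refl

module _ {A : Set} where

  countᵇ-≤-length : ∀ p (xs : List A) → countᵇ p xs ≤ length xs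
  countᵇ-≤-length p []       = z≤n
  countᵇ-≤-length p (x ∷ xs) with p x
  ... | true  = s≤s (countᵇ-≤-length p xs)
  ... | false = ℕP.m≤n⇒m≤1+n (countᵇ-≤-length p xs)

  countᵇ-mono : ∀ p q (xs : List A) → (∀ x → p x ≡ true → q x ≡ true) → countᵇ p xs ≤ countᵇ q xs
  countᵇ-mono p q []       p⇒q = z≤n
  countᵇ-mono p q (x ∷ xs) p⇒q with p x in px | q x in qx
  ... | true  | true  = s≤s (countᵇ-mono p q xs p⇒q)
  ... | true  | false with () ← trans (sym (p⇒q x px)) qx
  ... | false | true  = ℕP.m≤n⇒m≤1+n (countᵇ-mono p q xs p⇒q)
  ... | false | false = countᵇ-mono p q xs p⇒q

  countᵇ-cong : ∀ p q (xs : List A) → (∀ x → p x ≡ q x) → countᵇ p xs ≡ countᵇ q xs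
  countᵇ-cong p q xs p≗q = ℕP.≤-antisym
    (countᵇ-mono p q xs (λ x → trans (sym (p≗q x))))
    (countᵇ-mono q p xs (λ x → trans (p≗q x)))

  countᵇ-mono-< : ∀ p q {xs : List A} {y} → (∀ x → p x ≡ true → q x ≡ true) →
                  y ∈ xs → q y ≡ true → p y ≡ false → countᵇ p xs ℕ.< countᵇ q xs
  countᵇ-mono-< p q {x ∷ xs} p⇒q (here refl) qy py rewrite qy | py =
    s≤s (countᵇ-mono p q xs p⇒q)
  countᵇ-mono-< p q {x ∷ xs} p⇒q (there y∈xs) qy py with p x in px | q x in qx
  ... | true  | true  = s≤s (countᵇ-mono-< p q p⇒q y∈xs qy py)
  ... | true  | false with () ← trans (sym (p⇒q x px)) qx
  ... | false | true  = ℕP.m≤n⇒m≤1+n (countᵇ-mono-< p q p⇒q y∈xs qy py)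
  ... | false | false = countᵇ-mono-< p q p⇒q y∈xs qy py

  countᵇ-pos : ∀ p {xs : List A} {y} → y ∈ xs → p y ≡ true → 0 ℕ.< countᵇ p xs
  countᵇ-pos p {x ∷ xs} (here refl) py rewrite py = s≤s z≤n
  countᵇ-pos p {x ∷ xs} (there y∈xs) py with p x
  ... | true  = s≤s z≤n
  ... | false = countᵇ-pos p y∈xs py

countᵇ-∷ : ∀ {A : Set} (q : A → Bool) x xs → countᵇ q (x ∷ xs) ≡ (if q x then 1 else 0) ℕ.+ countᵇ q xs
countᵇ-∷ q x xs with q x
... | true  = refl
... | false = refl

module _ {A : Set} {P : A → Set} (p : A → Bool) where

  Any-filterᵇ⁺ : ∀ {xs} → Any (λ x → P x × p x ≡ true) xs → Any P (filterᵇ p xs)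
  Any-filterᵇ⁺ {x ∷ xs} any with p x in px
  Any-filterᵇ⁺ {x ∷ xs} (here (Px , _))  | true  = here Px
  Any-filterᵇ⁺ {x ∷ xs} (there any)      | true  = there (Any-filterᵇ⁺ any)
  Any-filterᵇ⁺ {x ∷ xs} (here (_ , px′)) | false with () ← trans (sym px′) px
  Any-filterᵇ⁺ {x ∷ xs} (there any)      | false = Any-filterᵇ⁺ any

  Any-filterᵇ⁻ : ∀ {xs} → Any P (filterᵇ p xs) → Any (λ x → P x × p x ≡ true) xs
  Any-filterᵇ⁻ {x ∷ xs} any with p x in px
  Any-filterᵇ⁻ {x ∷ xs} (here Px)   | true  = here (Px , px)
  Any-filterᵇ⁻ {x ∷ xs} (there any) | true  = there (Any-filterᵇ⁻ any)
  Any-filterᵇ⁻ {x ∷ xs} any         | false = there (Any-filterᵇ⁻ any)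

∈-filterᵇ⁺ : ∀ {A : Set} (p : A → Bool) {xs x} → x ∈ xs → p x ≡ true → x ∈ filterᵇ p xs
∈-filterᵇ⁺ p {xs} x∈xs px = Any-filterᵇ⁺ p {xs} (Any.map (λ { refl → refl , px }) x∈xs)

∈-filterᵇ⁻ : ∀ {A : Set} (p : A → Bool) {xs x} → x ∈ filterᵇ p xs → p x ≡ true
∈-filterᵇ⁻ p {xs} x∈ with Any.satisfied (Any-filterᵇ⁻ p {xs} x∈)
... | _ , refl , px = px

module _ {A : Set} {P : A → Set} where

  Any-removeAt⁻ : ∀ (xs : List A) i → Any P xs → P (lookup xs i) ⊎ Any P (removeAt xs i)
  Any-removeAt⁻ (x ∷ xs) zero    (here Px)   = inj₁ Px
  Any-removeAt⁻ (x ∷ xs) zero    (there any) = inj₂ any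
  Any-removeAt⁻ (x ∷ xs) (suc i) (here Px)   = inj₂ (here Px)
  Any-removeAt⁻ (x ∷ xs) (suc i) (there any) with Any-removeAt⁻ xs i any
  ... | inj₁ Px   = inj₁ Px
  ... | inj₂ any′ = inj₂ (there any′)

removeAt-map : ∀ {A B : Set} (f : A → B) (xs : List A) (j : Fin (length (map f xs))) →
  ∃ λ i → lookup (map f xs) j ≡ f (lookup xs i) × removeAt (map f xs) j ≡ map f (removeAt xs i)
removeAt-map f (x ∷ xs) zero    = zero , refl , refl
removeAt-map f (x ∷ xs) (suc j) with removeAt-map f xs j
... | i , lookup≡ , removeAt≡ = suc i , lookup≡ , cong (f x ∷_) removeAt≡

findᵇ-unique : ∀ {A : Set} (p : A → Bool) {xs y} → y ∈ xs → p y ≡ true →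
               (∀ x → p x ≡ true → x ≡ y) → findᵇ p xs ≡ just y
findᵇ-unique p {x ∷ xs} y∈ py unique with p x in px
... | true = cong just (unique x px)
findᵇ-unique p {x ∷ xs} (here refl)  py unique | false with () ← trans (sym py) px
findᵇ-unique p {x ∷ xs} (there y∈xs) py unique | false = findᵇ-unique p y∈xs py unique

module _ {A : Set} (f : A → ℕ) where

  ≤-maxOver : ∀ {xs x} → x ∈ xs → f x ≤ maxOver f xs
  ≤-maxOver (here refl)  = ℕP.m≤m⊔n _ _
  ≤-maxOver {y ∷ _} (there x∈xs) = ℕP.≤-trans (≤-maxOver x∈xs) (ℕP.m≤n⊔m (f y) _)

  maxOver-witness : ∀ {xs k} → suc k ≤ maxOver f xs → ∃ λ x → x ∈ xs × suc k ≤ f x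
  maxOver-witness {y ∷ xs} {k} h with ℕP.⊔-sel (f y) (maxOver f xs)
  ... | inj₁ eq = y , here refl , subst (suc k ≤_) eq h
  ... | inj₂ eq with maxOver-witness (subst (suc k ≤_) eq h)
  ...   | x , x∈xs , le = x , there x∈xs , le

least : (f : ℕ → Bool) → ∀ j → f j ≡ true →
        Σ ℕ λ d → f d ≡ true × (∀ i → i ℕ.< d → f i ≡ false)
least f j fj = search 0 j (λ _ ()) fj
  where
  search : ∀ i fuel → (∀ i′ → i′ ℕ.< i → f i′ ≡ false) → f (i ℕ.+ fuel) ≡ true →
           Σ ℕ λ d → f d ≡ true × (∀ i → i ℕ.< d → f i ≡ false)
  search i fuel below h with f i in fi
  ... | true = i , fi , below
  search i zero below h | false with () ← trans (sym h) (trans (cong f (ℕP.+-identityʳ i)) fi)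
  search i (suc fuel) below h | false =
    search (suc i) fuel below′ (trans (cong f (sym (ℕP.+-suc i fuel))) h)
    where
    below′ : ∀ i′ → i′ ℕ.< suc i → f i′ ≡ false
    below′ i′ i′<1+i with ℕP.m≤n⇒m<n∨m≡n (ℕP.≤-pred i′<1+i)
    ... | inj₁ i′<i  = below i′ i′<i
    ... | inj₂ refl  = fi

module _ {m : ℕ} where

  Joins : Fin m → Fin m → Fin m × Fin m → Set
  Joins a b e = (proj₁ e ≡ a × proj₂ e ≡ b) ⊎ (proj₁ e ≡ b × proj₂ e ≡ a)

  Adj : List (Fin m × Fin m) → Fin m → Fin m → Set
  Adj E a b = Any (Joins a b) E

  Walk : List (Fin m × Fin m) → Fin m → Fin m → Set
  Walk E = Star (Adj E)

  Joins-sym : ∀ {a b e} → Joins a b e → Joins b a e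
  Joins-sym (inj₁ p) = inj₂ p
  Joins-sym (inj₂ p) = inj₁ p

  Adj-sym : ∀ {E a b} → Adj E a b → Adj E b a
  Adj-sym = Any.map Joins-sym

  Walk-sym : ∀ {E a b} → Walk E a b → Walk E b a
  Walk-sym = Star.reverse Adj-sym

  neighbourᵇ : List (Fin m × Fin m) → (Fin m → Bool) → Fin m → Bool
  neighbourᵇ E R x = foldr (λ e r → ((proj₁ e == x) ∧ R (proj₂ e))
                                   ∨ ((proj₂ e == x) ∧ R (proj₁ e)) ∨ r) false E

  neighbourᵇ-sound : ∀ E R x → neighbourᵇ E R x ≡ true → ∃ λ y → R y ≡ true × Adj E y x
  neighbourᵇ-sound ((p , q) ∷ E) R x h with ∨-true⁻ {(p == x) ∧ R q} h
  ... | inj₁ h₁ with ∧-true⁻ {p == x} h₁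
  ...   | p≡x , Rq = q , Rq , here (inj₂ (==⇒≡ p≡x , refl))
  neighbourᵇ-sound ((p , q) ∷ E) R x h | inj₂ h₂ with ∨-true⁻ {(q == x) ∧ R p} h₂
  ... | inj₁ h₃ with ∧-true⁻ {q == x} h₃
  ...   | q≡x , Rp = p , Rp , here (inj₁ (refl , ==⇒≡ q≡x))
  neighbourᵇ-sound ((p , q) ∷ E) R x h | inj₂ h₂ | inj₂ h₄ with neighbourᵇ-sound E R x h₄
  ... | y , Ry , adj = y , Ry , there adj

  neighbourᵇ-complete : ∀ E R {x y} → R y ≡ true → Adj E y x → neighbourᵇ E R x ≡ true
  neighbourᵇ-complete ((p , q) ∷ E) R Ry (here (inj₁ (refl , refl))) =
    ∨-trueʳ ((p == q) ∧ R q) (∨-trueˡ _ (∧-true⁺ (==-refl q) Ry))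
  neighbourᵇ-complete ((p , q) ∷ E) R Ry (here (inj₂ (refl , refl))) =
    ∨-trueˡ _ (∧-true⁺ (==-refl p) Ry)
  neighbourᵇ-complete ((p , q) ∷ E) R {x} Ry (there adj) =
    ∨-trueʳ ((p == x) ∧ R q) (∨-trueʳ ((q == x) ∧ R p) (neighbourᵇ-complete E R Ry adj))

  step-⊇ : ∀ E R x → R x ≡ true → step E R x ≡ true
  step-⊇ E R x = ∨-trueˡ (neighbourᵇ E R x)

  iter-⊇ : ∀ E j R x → R x ≡ true → iter E j R x ≡ true
  iter-⊇ E zero    R x Rx = Rx
  iter-⊇ E (suc j) R x Rx = step-⊇ E (iter E j R) x (iter-⊇ E j R x Rx)

  iter-sound : ∀ E j R x → iter E j R x ≡ true → ∃ λ y → R y ≡ true × Walk E y x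
  iter-sound E zero    R x h = x , h , ε
  iter-sound E (suc j) R x h with ∨-true⁻ {iter E j R x} h
  ... | inj₁ h₁ = iter-sound E j R x h₁
  ... | inj₂ h₂ with neighbourᵇ-sound E (iter E j R) x h₂
  ...   | y , Ry , adj with iter-sound E j R y Ry
  ...     | z , Rz , walk = z , Rz , walk ◅◅ (adj ◅ ε)

  reach-refl : ∀ E s → reach E s s ≡ true
  reach-refl E s = iter-⊇ E m _ s (==-refl s)

  reach⇒Walk : ∀ E s x → reach E s x ≡ true → Walk E s x
  reach⇒Walk E s x h with iter-sound E m (s ==_) x h
  ... | y , s≡y , walk = subst (λ z → Walk E z x) (sym (==⇒≡ s≡y)) walk

  card : (Fin m → Bool) → ℕ
  card R = countᵇ R (allFin m)

  Closed : List (Fin m × Fin m) → (Fin m → Bool) → Set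
  Closed E R = ∀ x → step E R x ≡ true → R x ≡ true

  closed-or-grows : ∀ E R → Closed E R ⊎ card R ℕ.< card (step E R)
  closed-or-grows E R with FinP.any? (λ x → (step E R x ∧ not (R x)) Bool.≟ true)
  ... | yes (x , h) with ∧-true⁻ {step E R x} h
  ...   | sx , nRx = inj₂ (countᵇ-mono-< R (step E R) (step-⊇ E R) (∈-allFin x) sx (not-injective nRx))
  closed-or-grows E R | no none = inj₁ λ x sx → closedAt x sx (λ h → none (x , h))
    where
    closedAt : ∀ x → step E R x ≡ true → ¬ ((step E R x ∧ not (R x)) ≡ true) → R x ≡ true
    closedAt x sx h with R x
    ... | true  = refl
    ... | false = ⊥-elim (h (trans (∧-identityʳ _) sx))

  step-Closed : ∀ E R → Closed E R → Closed E (step E R)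
  step-Closed E R closed x h with ∨-true⁻ {step E R x} h
  ... | inj₁ sx = sx
  ... | inj₂ nx with neighbourᵇ-sound E (step E R) x nx
  ...   | y , sy , adj = step-⊇ E R x (closed x (∨-trueʳ (R x) (neighbourᵇ-complete E R (closed y sy) adj)))

  -- Each unclosed round of the iteration adds a vertex, and there are only m vertices.
  iter-closed-or-large : ∀ E s j → Closed E (iter E j (s ==_)) ⊎ j ℕ.< card (iter E j (s ==_))
  iter-closed-or-large E s zero = inj₂ (countᵇ-pos (s ==_) (∈-allFin s) (==-refl s))
  iter-closed-or-large E s (suc j) with iter-closed-or-large E s j
  ... | inj₁ closed = inj₁ (step-Closed E _ closed)
  ... | inj₂ large with closed-or-grows E (iter E j (s ==_))
  ...   | inj₁ closed = inj₁ (step-Closed E _ closed)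
  ...   | inj₂ grows  = inj₂ (ℕP.≤-<-trans large grows)

  reach-Closed : ∀ E s → Closed E (reach E s)
  reach-Closed E s with iter-closed-or-large E s m
  ... | inj₁ closed = closed
  ... | inj₂ large  = ⊥-elim (ℕP.<⇒≱ large
        (ℕP.≤-trans (countᵇ-≤-length _ (allFin m)) (ℕP.≤-reflexive (length-tabulate _))))

  reach-Adj : ∀ E s {x y} → reach E s x ≡ true → Adj E x y → reach E s y ≡ true
  reach-Adj E s {x} {y} sx adj =
    reach-Closed E s y (∨-trueʳ (reach E s y) (neighbourᵇ-complete E (reach E s) sx adj))

  reach-Walk : ∀ E s {x y} → reach E s x ≡ true → Walk E x y → reach E s y ≡ true
  reach-Walk E s sx ε            = sx
  reach-Walk E s sx (adj ◅ walk) = reach-Walk E s (reach-Adj E s sx adj) walk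

  Walk⇒reach : ∀ E s x → Walk E s x → reach E s x ≡ true
  Walk⇒reach E s x = reach-Walk E s (reach-refl E s)

  reach-cong : ∀ E s {x y} → Walk E x y → reach E s x ≡ reach E s y
  reach-cong E s walk = true⇔⇒≡ (λ sx → reach-Walk E s sx walk) (λ sy → reach-Walk E s sy (Walk-sym walk))

Joins-shared : ∀ {m} {a b c d : Fin m} {e} → Joins a b e → Joins c d e → b ≡ d ⊎ (b ≡ c × d ≡ a)
Joins-shared (inj₁ (_ , q₁)) (inj₁ (_ , q₂)) = inj₁ (trans (sym q₁) q₂)
Joins-shared (inj₁ (p₁ , q₁)) (inj₂ (p₂ , q₂)) = inj₂ (trans (sym q₁) q₂ , trans (sym p₂) p₁)
Joins-shared (inj₂ (p₁ , q₁)) (inj₁ (p₂ , q₂)) = inj₂ (trans (sym p₁) p₂ , trans (sym q₂) q₁)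
Joins-shared (inj₂ (p₁ , _)) (inj₂ (p₂ , _)) = inj₁ (trans (sym p₁) p₂)

Joins-same : ∀ {m} {t s₁ s₂ : Fin m} {e} → Joins t s₁ e → Joins t s₂ e → s₁ ≡ s₂
Joins-same j₁ j₂ with Joins-shared j₁ j₂
... | inj₁ s₁≡s₂         = s₁≡s₂
... | inj₂ (s₁≡t , s₂≡t) = trans s₁≡t (sym s₂≡t)

Adj-loopless : ∀ {m} {E : List (Fin m × Fin m)} {a b} → Loopless E → Adj E a b → a ≢ b
Adj-loopless (p≢q ∷ _) (here (inj₁ (refl , refl))) = p≢q
Adj-loopless (p≢q ∷ _) (here (inj₂ (refl , refl))) = p≢q ∘ sym
Adj-loopless (_ ∷ loopless) (there adj) = Adj-loopless loopless adj

module _ {m : ℕ} where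

  adjᵇ : List (Fin m × Fin m) → Fin m → Fin m → Bool
  adjᵇ E t s = foldr (λ e r → ((proj₁ e == t) ∧ (proj₂ e == s))
                            ∨ ((proj₂ e == t) ∧ (proj₁ e == s)) ∨ r) false E

  adjᵇ-sound : ∀ E t s → adjᵇ E t s ≡ true → Adj E t s
  adjᵇ-sound ((p , q) ∷ E) t s h with ∨-true⁻ {(p == t) ∧ (q == s)} h
  ... | inj₁ h₁ with ∧-true⁻ {p == t} h₁
  ...   | p≡t , q≡s = here (inj₁ (==⇒≡ p≡t , ==⇒≡ q≡s))
  adjᵇ-sound ((p , q) ∷ E) t s h | inj₂ h₂ with ∨-true⁻ {(q == t) ∧ (p == s)} h₂
  ... | inj₁ h₃ with ∧-true⁻ {q == t} h₃
  ...   | q≡t , p≡s = here (inj₂ (==⇒≡ p≡s , ==⇒≡ q≡t))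
  adjᵇ-sound ((p , q) ∷ E) t s h | inj₂ h₂ | inj₂ h₄ = there (adjᵇ-sound E t s h₄)

  adjᵇ-complete : ∀ E {t s} → Adj E t s → adjᵇ E t s ≡ true
  adjᵇ-complete ((p , q) ∷ E) (here (inj₁ (refl , refl))) = ∨-trueˡ _ (∧-true⁺ (==-refl p) (==-refl q))
  adjᵇ-complete ((p , q) ∷ E) (here (inj₂ (refl , refl))) =
    ∨-trueʳ ((p == q) ∧ (q == p)) (∨-trueˡ _ (∧-true⁺ (==-refl q) (==-refl p)))
  adjᵇ-complete ((p , q) ∷ E) {t} {s} (there adj) =
    ∨-trueʳ ((p == t) ∧ (q == s)) (∨-trueʳ ((q == t) ∧ (p == s)) (adjᵇ-complete E adj))

-- Breadth-first search from zero gives every other vertex a parent edge towards zero,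
-- and no edge is the parent edge of two vertices.
module _ {m : ℕ} (E : List (Fin (suc m) × Fin (suc m))) (connected : ∀ y → reach E zero y ≡ true) where

  private
    level : Fin (suc m) → ℕ → Bool
    level v j = iter E j (zero ==_) v

    dist : Fin (suc m) → ℕ
    dist v = proj₁ (least (level v) (suc m) (connected v))

    dist-least : ∀ v j → level v j ≡ true → dist v ≤ j
    dist-least v j h with ℕP.≤-<-connex (dist v) j
    ... | inj₁ ≤j = ≤j
    ... | inj₂ j< with () ← trans (sym h) (proj₂ (proj₂ (least (level v) (suc m) (connected v))) j j<)

    record Parent (v : Fin (suc m)) : Set where
      field
        edge   : Fin (length E)
        parent : Fin (suc m)
        joins  : Joins parent v (lookup E edge)
        closer : dist parent ℕ.< dist v

    parentOf : ∀ x → Parent (suc x)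
    parentOf x with least (level (suc x)) (suc m) (connected (suc x)) in eq
    ... | suc d , h , below with ∨-true⁻ {level (suc x) d} h
    ...   | inj₁ h₁ with () ← trans (sym h₁) (below d (ℕP.n<1+n d))
    ...   | inj₂ h₂ with neighbourᵇ-sound E (iter E d (zero ==_)) (suc x) h₂
    ...     | w , w∈level , adj = record
      { edge   = Any.index adj
      ; parent = w
      ; joins  = AnyP.lookup-index adj
      ; closer = subst (dist w ℕ.<_) (sym (cong proj₁ eq)) (s≤s (dist-least w d w∈level))
      }

    parent-edge-injective : ∀ x y → Parent.edge (parentOf x) ≡ Parent.edge (parentOf y) → x ≡ y
    parent-edge-injective x y same with parentOf x | parentOf y
    ... | record { joins = jx ; closer = cx } | record { joins = jy ; closer = cy } rewrite same
      with Joins-shared jx jy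
    ... | inj₁ sx≡sy         = FinP.suc-injective sx≡sy
    ... | inj₂ (refl , refl) = ⊥-elim (ℕP.<-asym cx cy)

  connected⇒≤length : m ≤ length E
  connected⇒≤length = FinP.injective⇒≤ (λ {x} {y} → parent-edge-injective x y)

module _ {m : ℕ} where

  avoids : Fin m → Fin m × Fin m → Bool
  avoids t e = not ((proj₁ e == t) ∨ (proj₂ e == t))

  removeNode : List (Fin m × Fin m) → Fin m → List (Fin m × Fin m)
  removeNode E t = filterᵇ (avoids t) E

  private
    avoids⇒≢ : ∀ {t} e → avoids t e ≡ true → proj₁ e ≢ t × proj₂ e ≢ t
    avoids⇒≢ {t} (p , q) h with p == t in pt | q == t in qt
    ... | false | false = ==-false⇒≢ pt , ==-false⇒≢ qt

    ≢⇒avoids : ∀ {t} e → proj₁ e ≢ t → proj₂ e ≢ t → avoids t e ≡ true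
    ≢⇒avoids (p , q) p≢t q≢t rewrite ≢⇒==-false p≢t | ≢⇒==-false q≢t = refl

    Joins-≢ : ∀ {t a b : Fin m} {e} → Joins a b e → proj₁ e ≢ t × proj₂ e ≢ t → a ≢ t × b ≢ t
    Joins-≢ (inj₁ (refl , refl)) ends = ends
    Joins-≢ (inj₂ (refl , refl)) (b≢t , a≢t) = a≢t , b≢t

  Adj-removeNode⁻ : ∀ {E t a b} → Adj (removeNode E t) a b → Adj E a b × a ≢ t × b ≢ t
  Adj-removeNode⁻ {E} {t} adj with Any.satisfied (Any-filterᵇ⁻ (avoids t) {E} adj)
  ... | e , joins , avoid = Any.map proj₁ (Any-filterᵇ⁻ (avoids t) {E} adj) , Joins-≢ joins (avoids⇒≢ e avoid)

  Adj-removeNode⁺ : ∀ {E t a b} → Adj E a b → a ≢ t → b ≢ t → Adj (removeNode E t) a b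
  Adj-removeNode⁺ {E} {t} {a} {b} adj a≢t b≢t = Any-filterᵇ⁺ (avoids t) {E} (Any.map (λ j → j , avoid j) adj)
    where
    avoid : ∀ {e} → Joins a b e → avoids t e ≡ true
    avoid (inj₁ (refl , refl)) = ≢⇒avoids _ a≢t b≢t
    avoid (inj₂ (refl , refl)) = ≢⇒avoids _ b≢t a≢t

  Walk-removeNode-from : ∀ {E t h} → Walk (removeNode E t) t h → h ≡ t
  Walk-removeNode-from     ε         = refl
  Walk-removeNode-from {E} (adj ◅ _) = ⊥-elim (proj₁ (proj₂ (Adj-removeNode⁻ {E} adj)) refl)

  private
    Walk-split : ∀ {E t x h} → Walk E x h → h ≢ t →
                 Walk (removeNode E t) x h ⊎ ∃ λ s → Adj E t s × Walk (removeNode E t) s h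
    Walk-split ε h≢t = inj₁ ε
    Walk-split {E} {t} {x} (_◅_ {j = y} adj walk) h≢t with Walk-split walk h≢t
    ... | inj₂ branch = inj₂ branch
    ... | inj₁ walk′ with x ≟ t | y ≟ t
    ...   | yes refl | _        = inj₂ (y , adj , walk′)
    ...   | no _     | yes refl = ⊥-elim (h≢t (Walk-removeNode-from {E} walk′))
    ...   | no x≢t   | no y≢t   = inj₁ (Adj-removeNode⁺ {E} adj x≢t y≢t ◅ walk′)

  branch : ∀ {E t h} → Walk E t h → h ≢ t → ∃ λ s → Adj E t s × Walk (removeNode E t) s h
  branch {E} walk h≢t with Walk-split walk h≢t
  ... | inj₁ walk′ = ⊥-elim (h≢t (Walk-removeNode-from {E} walk′))
  ... | inj₂ br    = br

  IsTree⇒bridge : ∀ {E} → IsTree m E → (i : Fin (length E)) →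
                  ¬ Walk (removeAt E i) (proj₁ (lookup E i)) (proj₂ (lookup E i))
  IsTree⇒bridge {E} tree i bypass with IsTree.nonempty tree
  ... | s≤s _ = ℕP.<⇒≱ (ℕP.≤-reflexive one-fewer) still-connected
    where
    open IsTree tree
    reroute : ∀ {a b} → Adj E a b → Walk (removeAt E i) a b
    reroute adj with Any-removeAt⁻ E i adj
    ... | inj₂ adj′                 = adj′ ◅ ε
    ... | inj₁ (inj₁ (refl , refl)) = bypass
    ... | inj₁ (inj₂ (refl , refl)) = Walk-sym bypass
    still-connected : ℕ.pred m ≤ length (removeAt E i)
    still-connected = connected⇒≤length (removeAt E i) λ y →
      Walk⇒reach _ zero y (Star.kleisliStar (λ v → v) reroute (reach⇒Walk E zero y (connected zero y)))
    one-fewer : suc (length (removeAt E i)) ≡ ℕ.pred m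
    one-fewer = trans (sym (length-removeAt′ E i)) (cong ℕ.pred (trans (ℕP.+-comm 1 (length E)) edgeCount))

  branch-unique : ∀ {E} → IsTree m E → ∀ {t s₁ s₂ h} → Adj E t s₁ → Adj E t s₂ →
                  Walk (removeNode E t) s₁ h → Walk (removeNode E t) s₂ h → s₁ ≡ s₂
  branch-unique {E} tree {t} {s₁} adj₁ adj₂ walk₁ walk₂ with Any-removeAt⁻ E (Any.index adj₁) adj₂
  ... | inj₁ joins₂ = Joins-same (AnyP.lookup-index adj₁) joins₂
  ... | inj₂ adj₂′  = ⊥-elim (IsTree⇒bridge tree i (oriented (AnyP.lookup-index adj₁) cycle))
    where
    i : Fin (length E)
    i = Any.index adj₁
    avoid-i : ∀ {a b} → Adj (removeNode E t) a b → Adj (removeAt E i) a b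
    avoid-i adj with Adj-removeNode⁻ {E} adj
    ... | adj′ , a≢t , b≢t with Any-removeAt⁻ E i adj′
    ...   | inj₂ adj″ = adj″
    ...   | inj₁ joins with Joins-shared (Joins-sym (AnyP.lookup-index adj₁)) (Joins-sym joins)
    ...     | inj₁ t≡a       = ⊥-elim (a≢t (sym t≡a))
    ...     | inj₂ (t≡b , _) = ⊥-elim (b≢t (sym t≡b))
    cycle : Walk (removeAt E i) t s₁
    cycle = adj₂′ ◅ Star.map avoid-i (walk₂ ◅◅ Walk-sym walk₁)
    oriented : ∀ {F a b} {e : Fin m × Fin m} → Joins a b e → Walk F a b → Walk F (proj₁ e) (proj₂ e)
    oriented (inj₁ (refl , refl)) walk = walk
    oriented (inj₂ (refl , refl)) walk = Walk-sym walk

module _ (H : MGraph) where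
  open MGraph H

  deg≤Δ : ∀ {x} → isV x ≡ true → deg H x ≤ Δ H
  deg≤Δ {x} vx = ≤-maxOver (deg H) (∈-filterᵇ⁺ isV (∈-allFin x) vx)

  Δ-witness : ∀ {k} → suc k ≤ Δ H → ∃ λ x → isV x ≡ true × suc k ≤ deg H x
  Δ-witness h with maxOver-witness (deg H) h
  ... | x , x∈ , le = x , ∈-filterᵇ⁻ isV {allFin size} x∈ , le

data TorsoVertex (n m : ℕ) : Fin (n ℕ.+ m) → Set where
  vertex : (v : Fin n) → TorsoVertex n m (v ↑ˡ m)
  node   : (s : Fin m) → TorsoVertex n m (n ↑ʳ s)

torsoVertex : ∀ n {m} (x : Fin (n ℕ.+ m)) → TorsoVertex n m x
torsoVertex zero    x       = node x
torsoVertex (suc n) zero    = vertex zero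
torsoVertex (suc n) (suc x) with torsoVertex n x
... | vertex v = vertex (suc v)
... | node s   = node s

vertex≢node : ∀ {n m} (v : Fin n) (s : Fin m) → v ↑ˡ m ≢ n ↑ʳ s
vertex≢node {n} {m} v s eq
  with () ← trans (sym (FinP.splitAt-↑ˡ n v m)) (trans (cong (splitAt n) eq) (FinP.splitAt-↑ʳ n m s))

mapNodes : ∀ {n m M} → (Fin m → Fin M) → Fin (n ℕ.+ m) → Fin (n ℕ.+ M)
mapNodes {n} {m} {M} g x with splitAt n x
... | inj₁ v = v ↑ˡ M
... | inj₂ s = n ↑ʳ g s

mapNodes-vertex : ∀ {n m M} (g : Fin m → Fin M) (v : Fin n) → mapNodes g (v ↑ˡ m) ≡ v ↑ˡ M
mapNodes-vertex {n} {m} g v rewrite FinP.splitAt-↑ˡ n v m = refl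

mapNodes-node : ∀ {n m M} (g : Fin m → Fin M) (s : Fin m) → mapNodes {n} g (n ↑ʳ s) ≡ n ↑ʳ g s
mapNodes-node {n} {m} g s rewrite FinP.splitAt-↑ʳ n m s = refl

mapNodes-injective : ∀ {n m M} (g : Fin m → Fin M) → (∀ {a b} → g a ≡ g b → a ≡ b) →
                     ∀ {x y} → mapNodes {n} g x ≡ mapNodes {n} g y → x ≡ y
mapNodes-injective {n} {m} {M} g g-inj {x} {y} eq with torsoVertex n x | torsoVertex n y
... | vertex v | vertex v′ = cong (_↑ˡ m) (FinP.↑ˡ-injective M v v′
  (trans (sym (mapNodes-vertex g v)) (trans eq (mapNodes-vertex g v′))))
... | vertex v | node s = ⊥-elim (vertex≢node v (g s)
  (trans (sym (mapNodes-vertex g v)) (trans eq (mapNodes-node g s))))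
... | node s | vertex v = ⊥-elim (vertex≢node v (g s)
  (trans (sym (mapNodes-vertex g v)) (trans (sym eq) (mapNodes-node g s))))
... | node s | node s′ = cong (n ↑ʳ_) (g-inj (FinP.↑ʳ-injective n (g s) (g s′)
  (trans (sym (mapNodes-node g s)) (trans eq (mapNodes-node g s′)))))

imageᵇ : ∀ {N} → (Fin N × Fin N → Bool) → Maybe (Fin N) → Maybe (Fin N) → Bool
imageᵇ q (just a) (just b) = if a == b then false else q (a , b)
imageᵇ q (just a) nothing  = false
imageᵇ q nothing  _        = false

module _ {n : ℕ} (EG : List (Fin n × Fin n)) (D : TreePartition n) where
  open TreePartition D

  data Image (t : Fin m) (v : Fin n) : Fin (n ℕ.+ m) → Set where
    inside  : bag v ≡ t → Image t v (v ↑ˡ m)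
    outside : ∀ {s} → bag v ≢ t → Adj tedges t s → Walk (removeNode tedges t) s (bag v) → Image t v (n ↑ʳ s)

  compOf-branch : ∀ {t s h} → Adj tedges t s → Walk (removeNode tedges t) s h → compOf EG D t h ≡ just s
  compOf-branch {t} {s} {h} adj walk = findᵇ-unique _ (∈-allFin s)
    (∧-true⁺ (adjᵇ-complete tedges adj) (Walk⇒reach _ s h walk))
    (λ s′ found → let adj′ , reach′ = ∧-true⁻ {adjT EG D t s′} found in
      branch-unique isTree (adjᵇ-sound tedges t s′ adj′) adj (reach⇒Walk _ s′ h reach′) walk)

  Image⇒π : ∀ {t v a} → Image t v a → π EG D t v ≡ just a
  Image⇒π {v = v} (inside refl) rewrite ==-refl (bag v) = refl
  Image⇒π (outside v∉t adj walk) rewrite ≢⇒==-false v∉t | compOf-branch adj walk = refl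

  image : ∀ t v → ∃ (Image t v)
  image t v with bag v ≟ t
  ... | yes v∈t = _ , inside v∈t
  ... | no v∉t with branch (reach⇒Walk tedges t (bag v) (IsTree.connected isTree t (bag v))) v∉t
  ...   | s , adj , walk = _ , outside v∉t adj walk

  Image⇒π-cong : ∀ {t v a b} → a ≡ b → Image t v a → π EG D t v ≡ just b
  Image⇒π-cong refl = Image⇒π

  π⇒Image : ∀ {t v a} → π EG D t v ≡ just a → Image t v a
  π⇒Image {t} {v} eq with image t v
  ... | _ , img with trans (sym eq) (Image⇒π img)
  ...   | refl = img

  torsoV-vertex : ∀ t v → torsoV EG D t (v ↑ˡ m) ≡ (bag v == t)
  torsoV-vertex t v rewrite FinP.splitAt-↑ˡ n v m = refl

  torsoV-node : ∀ t s → torsoV EG D t (n ↑ʳ s) ≡ adjᵇ tedges t s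
  torsoV-node t s rewrite FinP.splitAt-↑ʳ n m s = refl

  torsoV-vertex⇒bag : ∀ {t v} → torsoV EG D t (v ↑ˡ m) ≡ true → bag v ≡ t
  torsoV-vertex⇒bag {t} {v} v∈Z = ==⇒≡ (trans (sym (torsoV-vertex t v)) v∈Z)

  torsoV-node⇒Adj : ∀ {t s} → torsoV EG D t (n ↑ʳ s) ≡ true → Adj tedges t s
  torsoV-node⇒Adj {t} {s} s∈Z = adjᵇ-sound tedges t s (trans (sym (torsoV-node t s)) s∈Z)

  countᵇ-torsoEdges : ∀ t q L → countᵇ q (torsoEdges EG D t L)
                      ≡ countᵇ (λ e → imageᵇ q (π EG D t (proj₁ e)) (π EG D t (proj₂ e))) L
  countᵇ-torsoEdges t q [] = refl
  countᵇ-torsoEdges t q (e ∷ L) with π EG D t (proj₁ e) | π EG D t (proj₂ e)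
  ... | just a  | just b with a == b
  ...   | true  = countᵇ-torsoEdges t q L
  ...   | false with q (a , b)
  ...     | true  = cong suc (countᵇ-torsoEdges t q L)
  ...     | false = countᵇ-torsoEdges t q L
  countᵇ-torsoEdges t q (e ∷ L) | just _  | nothing = countᵇ-torsoEdges t q L
  countᵇ-torsoEdges t q (e ∷ L) | nothing | _       = countᵇ-torsoEdges t q L

incident-map : ∀ {N M} (f : Fin N → Fin M) {x} → (∀ {y} → f y ≡ f x → y ≡ x) → ∀ a b →
  (if a == b then false else ((a == x) ∨ (b == x))) ≡ true →
  (if f a == f b then false else ((f a == f x) ∨ (f b == f x))) ≡ true
incident-map f {x} fibre a b h with a ≟ b | f a ≟ f b
incident-map f fibre a b () | yes _ | _
... | no a≢b | no _ with ∨-true⁻ {a == x} h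
...   | inj₁ a≡x = ∨-trueˡ _ (≡⇒== (cong f (==⇒≡ a≡x)))
...   | inj₂ b≡x = ∨-trueʳ _ (≡⇒== (cong f (==⇒≡ b≡x)))
incident-map f {x} fibre a b h | no a≢b | yes fa≡fb with ∨-true⁻ {a == x} h
...   | inj₁ a≡x = ⊥-elim (a≢b (trans (==⇒≡ a≡x)
                     (sym (fibre (trans (sym fa≡fb) (cong f (==⇒≡ a≡x)))))))
...   | inj₂ b≡x = ⊥-elim (a≢b (trans (fibre (trans fa≡fb (cong f (==⇒≡ b≡x)))) (sym (==⇒≡ b≡x))))

-- Every torso edge at x is sent to a torso edge at f x; injectivity at x keeps it from
-- collapsing to a loop.
deg-≤-torso-map : ∀ {n} (EG : List (Fin n × Fin n)) (D₁ D₂ : TreePartition n) t₁ t₂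
  (f : Fin (n ℕ.+ TreePartition.m D₁) → Fin (n ℕ.+ TreePartition.m D₂)) x →
  (∀ {v a} → π EG D₁ t₁ v ≡ just a → π EG D₂ t₂ v ≡ just (f a)) →
  (∀ {y} → f y ≡ f x → y ≡ x) →
  deg (torso EG D₁ t₁) x ≤ deg (torso EG D₂ t₂) (f x)
deg-≤-torso-map {n} EG D₁ D₂ t₁ t₂ f x π-map fibre = begin
  deg (torso EG D₁ t₁) x
    ≡⟨ countᵇ-torsoEdges EG D₁ t₁ _ EG ⟩
  countᵇ (λ e → imageᵇ incident₁ (π₁ (proj₁ e)) (π₁ (proj₂ e))) EG
    ≤⟨ countᵇ-mono _ _ EG image-incident ⟩
  countᵇ (λ e → imageᵇ incident₂ (π₂ (proj₁ e)) (π₂ (proj₂ e))) EG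
    ≡⟨ countᵇ-torsoEdges EG D₂ t₂ _ EG ⟨
  deg (torso EG D₂ t₂) (f x) ∎
  where
  open ℕP.≤-Reasoning
  π₁ : Fin n → Maybe (Fin (n ℕ.+ TreePartition.m D₁))
  π₁ = π EG D₁ t₁
  π₂ : Fin n → Maybe (Fin (n ℕ.+ TreePartition.m D₂))
  π₂ = π EG D₂ t₂
  incident₁ : Fin (n ℕ.+ TreePartition.m D₁) × Fin (n ℕ.+ TreePartition.m D₁) → Bool
  incident₁ e = (proj₁ e == x) ∨ (proj₂ e == x)
  incident₂ : Fin (n ℕ.+ TreePartition.m D₂) × Fin (n ℕ.+ TreePartition.m D₂) → Bool
  incident₂ e = (proj₁ e == f x) ∨ (proj₂ e == f x)
  image-incident : ∀ e → imageᵇ incident₁ (π₁ (proj₁ e)) (π₁ (proj₂ e)) ≡ true →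
                         imageᵇ incident₂ (π₂ (proj₁ e)) (π₂ (proj₂ e)) ≡ true
  image-incident (u , v) h with π₁ u in πu | π₁ v in πv
  ... | just a | just b rewrite π-map πu | π-map πv = incident-map f fibre a b h

-- The two halves of t are the nodes half true = suc t and half false = zero, joined by the
-- new tree edge; every other node s becomes suc s, and merge undoes the split.
module Split {n : ℕ} (D : TreePartition n) (t : Fin (TreePartition.m D))
             (X : Fin (n ℕ.+ TreePartition.m D) → Bool) where
  open TreePartition D

  half : Bool → Fin (suc m)
  half true  = suc t
  half false = zero

  node′ : Fin m → Fin m → Fin (suc m)
  node′ a b = if a == t then half (X (n ↑ʳ b)) else suc a

  edge′ : Fin m × Fin m → Fin (suc m) × Fin (suc m)
  edge′ e = node′ (proj₁ e) (proj₂ e) , node′ (proj₂ e) (proj₁ e)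

  lifted : List (Fin m × Fin m) → List (Fin (suc m) × Fin (suc m))
  lifted F = (half true , half false) ∷ map edge′ F

  bag′ : Fin n → Fin (suc m)
  bag′ v = if bag v == t then half (X (v ↑ˡ m)) else suc (bag v)

  merge : Fin (suc m) → Fin m
  merge zero    = t
  merge (suc s) = s

  merge-half : ∀ β → merge (half β) ≡ t
  merge-half true  = refl
  merge-half false = refl

  merge-node′ : ∀ a b → merge (node′ a b) ≡ a
  merge-node′ a b with a ≟ t
  ... | yes refl = merge-half (X (n ↑ʳ b))
  ... | no _     = refl

  merge-bag′ : ∀ v → merge (bag′ v) ≡ bag v
  merge-bag′ v with bag v ≟ t
  ... | yes v∈t = trans (merge-half (X (v ↑ˡ m))) (sym v∈t)
  ... | no _    = refl

  node′-t : ∀ b → node′ t b ≡ half (X (n ↑ʳ b))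
  node′-t b rewrite ==-refl t = refl

  node′-≢ : ∀ {a} b → a ≢ t → node′ a b ≡ suc a
  node′-≢ b a≢t rewrite ≢⇒==-false a≢t = refl

  bag′-t : ∀ {v} → bag v ≡ t → bag′ v ≡ half (X (v ↑ˡ m))
  bag′-t refl rewrite ==-refl t = refl

  bag′-≢ : ∀ {v} → bag v ≢ t → bag′ v ≡ suc (bag v)
  bag′-≢ v∉t rewrite ≢⇒==-false v∉t = refl

  half≢suc : ∀ β {s} → s ≢ t → half β ≢ suc s
  half≢suc true  s≢t eq = s≢t (sym (FinP.suc-injective eq))
  half≢suc false s≢t ()

  half≢half-not : ∀ β → half β ≢ half (not β)
  half≢half-not true  ()
  half≢half-not false ()

  bag′≢half : ∀ β {v} → bag v ≢ t → bag′ v ≢ half β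
  bag′≢half β v∉t eq = half≢suc β v∉t (trans (sym eq) (bag′-≢ v∉t))

  ≢-merge : ∀ {x y} → merge x ≢ merge y → x ≢ y
  ≢-merge neq refl = neq refl

  Adj-halves : ∀ {F} β → Adj (lifted F) (half β) (half (not β))
  Adj-halves true  = here (inj₁ (refl , refl))
  Adj-halves false = here (inj₂ (refl , refl))

  Adj-edge′ : ∀ {F a b} → Adj F a b → Adj (map edge′ F) (node′ a b) (node′ b a)
  Adj-edge′ = AnyP.map⁺ ∘ Any.map (λ { (inj₁ (refl , refl)) → inj₁ (refl , refl)
                                     ; (inj₂ (refl , refl)) → inj₂ (refl , refl) })

  Adj-merge : ∀ {F p q} → Adj (map edge′ F) p q → Adj F (merge p) (merge q)
  Adj-merge = Any.map merge-ends ∘ AnyP.map⁻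
    where
    merge-ends : ∀ {p q e} → Joins p q (edge′ e) → Joins (merge p) (merge q) e
    merge-ends {e = a , b} (inj₁ (refl , refl)) = inj₁ (sym (merge-node′ a b) , sym (merge-node′ b a))
    merge-ends {e = a , b} (inj₂ (refl , refl)) = inj₂ (sym (merge-node′ a b) , sym (merge-node′ b a))

  module _ {F : List (Fin m × Fin m)} {F′ : List (Fin (suc m) × Fin (suc m))}
           (lift-adj : ∀ {a b} → Adj F a b → Adj F′ (node′ a b) (node′ b a))
           (halves : Adj F′ (half true) (half false)) where

    Walk-fibre : ∀ {x y} → merge x ≡ merge y → Walk F′ x y
    Walk-fibre {zero}  {zero}   _    = ε
    Walk-fibre {zero}  {suc _}  refl = Adj-sym halves ◅ ε
    Walk-fibre {suc _} {zero}   refl = halves ◅ ε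
    Walk-fibre {suc _} {suc _}  refl = ε

    Walk-lift : ∀ {a b} → Walk F a b → ∀ {x y} → merge x ≡ a → merge y ≡ b → Walk F′ x y
    Walk-lift ε x≡a y≡b = Walk-fibre (trans x≡a (sym y≡b))
    Walk-lift (_◅_ {j = c} adj walk) x≡a y≡b =
      Walk-fibre (trans x≡a (sym (merge-node′ _ c))) ◅◅ (lift-adj adj ◅ Walk-lift walk (merge-node′ c _) y≡b)

  reach-lifted : ∀ F a b x → reach (lifted F) (node′ a b) x ≡ reach F a (merge x)
  reach-lifted F a b x = true⇔⇒≡
    (λ h → Walk⇒reach F a (merge x)
      (subst (λ c → Walk F c (merge x)) (merge-node′ a b)
        (Star.kleisliStar merge project (reach⇒Walk (lifted F) (node′ a b) x h))))
    (λ h → Walk⇒reach (lifted F) (node′ a b) x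
      (Walk-lift (there ∘ Adj-edge′) (Adj-halves true) (reach⇒Walk F a (merge x) h) (merge-node′ a b) refl))
    where
    project : ∀ {p q} → Adj (lifted F) p q → Walk F (merge p) (merge q)
    project (here (inj₁ (refl , refl))) = ε
    project (here (inj₂ (refl , refl))) = ε
    project (there adj)                 = Adj-merge adj ◅ ε

  tree′ : IsTree (suc m) (lifted tedges)
  tree′ = record
    { nonempty  = s≤s z≤n
    ; loopless  = (λ ()) ∷ AllP.map⁺ (All.map edge′-loopless loopless)
    ; connected = λ x y → Walk⇒reach (lifted tedges) x y
        (Walk-lift (there ∘ Adj-edge′) (Adj-halves true)
                   (reach⇒Walk tedges _ _ (connected (merge x) (merge y))) refl refl)
    ; edgeCount = cong suc (trans (cong (ℕ._+ 1) (length-map edge′ tedges)) edgeCount)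
    }
    where
    open IsTree isTree
    edge′-loopless : ∀ {e} → proj₁ e ≢ proj₂ e → proj₁ (edge′ e) ≢ proj₂ (edge′ e)
    edge′-loopless {a , b} a≢b eq = a≢b (trans (sym (merge-node′ a b)) (trans (cong merge eq) (merge-node′ b a)))

  D′ : TreePartition n
  D′ = record { m = suc m ; tedges = lifted tedges ; isTree = tree′ ; bag = bag′ }

  Adj-suc : ∀ {a b} → Adj (removeNode tedges t) a b → Adj (map edge′ tedges) (suc a) (suc b)
  Adj-suc {a} {b} adj with Adj-removeNode⁻ {E = tedges} adj
  ... | adj′ , a≢t , b≢t = subst₂ (Adj _) (node′-≢ b a≢t) (node′-≢ a b≢t) (Adj-edge′ adj′)

  Adj-lift-removeNode : ∀ {r r′ a b} → merge r′ ≡ r → Adj (removeNode tedges r) a b →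
                        Adj (removeNode (lifted tedges) r′) (node′ a b) (node′ b a)
  Adj-lift-removeNode {r′ = r′} {a} {b} refl adj with Adj-removeNode⁻ {E = tedges} adj
  ... | adj′ , a≢r , b≢r = Adj-removeNode⁺ {E = lifted tedges} {t = r′} (there (Adj-edge′ adj′))
    (λ eq → a≢r (trans (sym (merge-node′ a b)) (cong merge eq)))
    (λ eq → b≢r (trans (sym (merge-node′ b a)) (cong merge eq)))

  branch-root : ∀ {s} → Adj tedges t s → s ≢ t
  branch-root adj = Adj-loopless (IsTree.loopless isTree) adj ∘ sym

  Adj-branch : ∀ {s} → Adj tedges t s → Adj (lifted tedges) (half (X (n ↑ʳ s))) (suc s)
  Adj-branch {s} adj =
    subst₂ (Adj (lifted tedges)) (node′-t s) (node′-≢ t (branch-root adj)) (there (Adj-edge′ adj))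

  image-half : Bool → Fin (n ℕ.+ m) → Fin (n ℕ.+ suc m)
  image-half β a = if does (X a Bool.≟ β) then mapNodes suc a else n ↑ʳ half (not β)

  image-half-same : ∀ {β a} → X a ≡ β → image-half β a ≡ mapNodes suc a
  image-half-same {β} {a} Xa≡β rewrite dec-true (X a Bool.≟ β) Xa≡β = refl

  image-half-other : ∀ {β a} → X a ≢ β → image-half β a ≡ n ↑ʳ half (not β)
  image-half-other {β} {a} Xa≢β rewrite dec-false (X a Bool.≟ β) Xa≢β = refl

  module _ (EG : List (Fin n × Fin n)) where

    side : Fin (suc m) → Bool
    side = reach (map edge′ tedges) (half true)

    side-half : ∀ β → side (half β) ≡ β
    side-half true = reach-refl (map edge′ tedges) (half true)
    side-half false with side zero in eq
    ... | false = refl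
    ... | true  = ⊥-elim (IsTree⇒bridge tree′ zero (reach⇒Walk (map edge′ tedges) (half true) zero eq))

    side-bag′ : ∀ {v a} → Image EG D t v a → side (bag′ v) ≡ X a
    side-bag′ {v} (inside v∈t) rewrite bag′-t v∈t = side-half (X (v ↑ˡ m))
    side-bag′ {v} (outside {s} v∉t adj walk) = begin
      side (bag′ v)             ≡⟨ cong side (bag′-≢ v∉t) ⟩
      side (suc (bag v))        ≡⟨ reach-cong (map edge′ tedges) (half true) walk′ ⟨
      side (half (X (n ↑ʳ s)))  ≡⟨ side-half (X (n ↑ʳ s)) ⟩
      X (n ↑ʳ s)                ∎
      where
      open ≡-Reasoning
      walk′ : Walk (map edge′ tedges) (half (X (n ↑ʳ s))) (suc (bag v))
      walk′ = subst₂ (Adj _) (node′-t s) (node′-≢ t (branch-root adj)) (Adj-edge′ adj)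
              ◅ Star.gmap suc Adj-suc walk

    cross-new : cross EG D′ zero ≤ cutSize (torso EG D t) X
    cross-new = begin
      cross EG D′ zero
        ≤⟨ countᵇ-mono _ _ EG crossing ⟩
      countᵇ (λ e → imageᵇ cutᵇ (π₀ (proj₁ e)) (π₀ (proj₂ e))) EG
        ≡⟨ countᵇ-torsoEdges EG D t _ EG ⟨
      cutSize (torso EG D t) X ∎
      where
      open ℕP.≤-Reasoning
      π₀ : Fin n → Maybe (Fin (n ℕ.+ m))
      π₀ = π EG D t
      cutᵇ : Fin (n ℕ.+ m) × Fin (n ℕ.+ m) → Bool
      cutᵇ e = X (proj₁ e) xor X (proj₂ e)
      crossing : ∀ e → (side (bag′ (proj₁ e)) xor side (bag′ (proj₂ e))) ≡ true →
                 imageᵇ cutᵇ (π₀ (proj₁ e)) (π₀ (proj₂ e)) ≡ true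
      crossing (u , v) h with image EG D t u | image EG D t v
      ... | a , img-u | b , img-v
        rewrite Image⇒π EG D img-u | Image⇒π EG D img-v | side-bag′ img-u | side-bag′ img-v
        with a ≟ b
      ... | yes refl with () ← trans (sym h) (xor-same (X a))
      ... | no _     = h

    cross-old : ∀ j → ∃ λ i → cross EG D′ (suc j) ≡ cross EG D i
    cross-old j with removeAt-map edge′ tedges j
    ... | i , lookup≡ , removeAt≡ = i , countᵇ-cong _ _ EG same-sides
      where
      new-side : Fin (suc m) → Bool
      new-side = reach ((half true , half false) ∷ removeAt (map edge′ tedges) j)
                       (proj₁ (lookup (map edge′ tedges) j))
      old-side : Fin m → Bool
      old-side = reach (removeAt tedges i) (proj₁ (lookup tedges i))
      sides-agree : ∀ x → new-side x ≡ old-side (merge x)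
      sides-agree x rewrite lookup≡ | removeAt≡ =
        reach-lifted (removeAt tedges i) (proj₁ (lookup tedges i)) (proj₂ (lookup tedges i)) x
      same-sides : ∀ e → (new-side (bag′ (proj₁ e)) xor new-side (bag′ (proj₂ e)))
                       ≡ (old-side (bag (proj₁ e)) xor old-side (bag (proj₂ e)))
      same-sides (u , v) rewrite sides-agree (bag′ u) | sides-agree (bag′ v) | merge-bag′ u | merge-bag′ v = refl

    adhesion′ : ∀ {k} → AdhesionAtMost EG D k → cutSize (torso EG D t) X ≤ k → AdhesionAtMost EG D′ k
    adhesion′ adh cut zero    = ℕP.≤-trans cross-new cut
    adhesion′ {k} adh cut (suc j) with cross-old j
    ... | i , same = subst (_≤ k) (sym same) (adh i)

    Walk-suc : ∀ {β a b} → Walk (removeNode tedges t) a b →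
               Walk (removeNode (lifted tedges) (half β)) (suc a) (suc b)
    Walk-suc {β} = Star.gmap suc λ {a} {b} adj →
      let _ , a≢t , b≢t = Adj-removeNode⁻ {E = tedges} adj in
      Adj-removeNode⁺ {E = lifted tedges} (there (Adj-suc adj)) (half≢suc β a≢t ∘ sym) (half≢suc β b≢t ∘ sym)

    π-half : ∀ β {v a} → π EG D t v ≡ just a → π EG D′ (half β) v ≡ just (image-half β a)
    π-half β {v} eq with π⇒Image EG D eq
    ... | inside v∈t with toSum (X (v ↑ˡ m) Bool.≟ β)
    ...   | inj₁ Xv≡β =
      Image⇒π-cong EG D′ (sym (trans (image-half-same Xv≡β) (mapNodes-vertex {n} suc v)))
        (inside (trans (bag′-t v∈t) (cong half Xv≡β)))
    ...   | inj₂ Xv≢β =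
      Image⇒π-cong EG D′ (sym (image-half-other Xv≢β))
        (outside (λ eq → half≢half-not β (trans (sym eq) bag′-other)) (Adj-halves β)
                 (subst (Walk _ _) (sym bag′-other) ε))
      where
      bag′-other : bag′ v ≡ half (not β)
      bag′-other = trans (bag′-t v∈t) (cong half (¬-not Xv≢β))
    π-half β {v} eq | outside {s} v∉t adj walk with toSum (X (n ↑ʳ s) Bool.≟ β)
    ... | inj₁ Xs≡β =
      Image⇒π-cong EG D′ (sym (trans (image-half-same Xs≡β) (mapNodes-node {n} suc s)))
        (outside (bag′≢half β v∉t) (subst (λ γ → Adj (lifted tedges) (half γ) (suc s)) Xs≡β (Adj-branch adj))
                 (subst (Walk _ _) (sym (bag′-≢ v∉t)) (Walk-suc {β} walk)))
    ... | inj₂ Xs≢β =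
      Image⇒π-cong EG D′ (sym (image-half-other Xs≢β))
        (outside (bag′≢half β v∉t) (Adj-halves β)
                 (cross-over ◅ subst (Walk _ _) (sym (bag′-≢ v∉t)) (Walk-suc {β} walk)))
      where
      cross-over : Adj (removeNode (lifted tedges) (half β)) (half (not β)) (suc s)
      cross-over = Adj-removeNode⁺ {E = lifted tedges}
        (subst (λ γ → Adj (lifted tedges) (half γ) (suc s)) (¬-not Xs≢β) (Adj-branch adj))
        (half≢half-not β ∘ sym) (half≢suc β (branch-root adj) ∘ sym)

    module _ {β x} (x∈Z : torsoV EG D t x ≡ true) (Xx≡β : X x ≡ β) where

      fibre-half : ∀ {y} → image-half β y ≡ image-half β x → y ≡ x
      fibre-half {y} eq with toSum (X y Bool.≟ β)
      ... | inj₁ Xy≡β = mapNodes-injective suc FinP.suc-injective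
                         (trans (sym (image-half-same Xy≡β)) (trans eq (image-half-same Xx≡β)))
      ... | inj₂ Xy≢β =
        ⊥-elim (other≢ (trans (sym (image-half-other Xy≢β)) (trans eq (image-half-same Xx≡β))))
        where
        other≢ : n ↑ʳ half (not β) ≢ mapNodes suc x
        other≢ eq′ with torsoVertex n x
        ... | vertex v = vertex≢node v (half (not β)) (sym (trans eq′ (mapNodes-vertex {n} suc v)))
        ... | node s   = half≢suc (not β) (branch-root (torsoV-node⇒Adj EG D x∈Z))
                           (FinP.↑ʳ-injective n _ _ (trans eq′ (mapNodes-node {n} suc s)))

      image-half∈torso : torsoV EG D′ (half β) (image-half β x) ≡ true
      image-half∈torso with torsoVertex n x
      ... | vertex v = begin
        torsoV EG D′ (half β) (image-half β (v ↑ˡ m))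
          ≡⟨ cong (torsoV EG D′ (half β)) (image-half-same Xx≡β) ⟩
        torsoV EG D′ (half β) (mapNodes suc (v ↑ˡ m))
          ≡⟨ cong (torsoV EG D′ (half β)) (mapNodes-vertex {n} suc v) ⟩
        torsoV EG D′ (half β) (v ↑ˡ suc m)
          ≡⟨ torsoV-vertex EG D′ (half β) v ⟩
        (bag′ v == half β)
          ≡⟨ ≡⇒== (trans (bag′-t v∈t) (cong half Xx≡β)) ⟩
        true ∎
        where
        open ≡-Reasoning
        v∈t : bag v ≡ t
        v∈t = torsoV-vertex⇒bag EG D x∈Z
      ... | node s = begin
        torsoV EG D′ (half β) (image-half β (n ↑ʳ s))
          ≡⟨ cong (torsoV EG D′ (half β)) (image-half-same Xx≡β) ⟩
        torsoV EG D′ (half β) (mapNodes suc (n ↑ʳ s))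
          ≡⟨ cong (torsoV EG D′ (half β)) (mapNodes-node {n} suc s) ⟩
        torsoV EG D′ (half β) (n ↑ʳ suc s)
          ≡⟨ torsoV-node EG D′ (half β) (suc s) ⟩
        adjᵇ (lifted tedges) (half β) (suc s)
          ≡⟨ adjᵇ-complete (lifted tedges) adj′ ⟩
        true ∎
        where
        open ≡-Reasoning
        adj′ : Adj (lifted tedges) (half β) (suc s)
        adj′ = subst (λ γ → Adj (lifted tedges) (half γ) (suc s)) Xx≡β (Adj-branch (torsoV-node⇒Adj EG D x∈Z))

      strength-half : ∀ {k} → suc k ≤ deg (torso EG D t) x → suc k ≤ Δ (torso EG D′ (half β))
      strength-half x-large = ℕP.≤-trans x-large (ℕP.≤-trans
        (deg-≤-torso-map EG D D′ t (half β) (image-half β) x (π-half β) fibre-half)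
        (deg≤Δ (torso EG D′ (half β)) image-half∈torso))

    module _ {r} (r≢t : r ≢ t) where

      image-other : Fin (n ℕ.+ m) → Fin (n ℕ.+ suc m)
      image-other = mapNodes (λ s → node′ s r)

      π-other : ∀ {v a} → π EG D r v ≡ just a → π EG D′ (suc r) v ≡ just (image-other a)
      π-other {v} eq with π⇒Image EG D eq
      ... | inside v∈r =
        Image⇒π-cong EG D′ (sym (mapNodes-vertex {n} _ v))
          (inside (trans (bag′-≢ (r≢t ∘ trans (sym v∈r))) (cong suc v∈r)))
      ... | outside {s} v∉r adj walk =
        Image⇒π-cong EG D′ (sym (mapNodes-node {n} _ s))
          (outside (≢-merge (v∉r ∘ trans (sym (merge-bag′ v))))
                   (subst (λ x → Adj (lifted tedges) x (node′ s r)) (node′-≢ s r≢t) (there (Adj-edge′ adj)))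
                   (Walk-lift (Adj-lift-removeNode {r′ = suc r} refl) halves walk
                              (merge-node′ s r) (merge-bag′ v)))
        where
        halves : Adj (removeNode (lifted tedges) (suc r)) (half true) (half false)
        halves = Adj-removeNode⁺ {E = lifted tedges} (Adj-halves true) (r≢t ∘ sym ∘ FinP.suc-injective) (λ ())

      image-other-injective : ∀ {x y} → image-other x ≡ image-other y → x ≡ y
      image-other-injective = mapNodes-injective _ λ {a} {b} eq →
        trans (sym (merge-node′ a r)) (trans (cong merge eq) (merge-node′ b r))

      image-other∈torso : ∀ {x} → torsoV EG D r x ≡ true → torsoV EG D′ (suc r) (image-other x) ≡ true
      image-other∈torso {x} x∈Z with torsoVertex n x
      ... | vertex v = begin
        torsoV EG D′ (suc r) (image-other (v ↑ˡ m))
          ≡⟨ cong (torsoV EG D′ (suc r)) (mapNodes-vertex {n} _ v) ⟩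
        torsoV EG D′ (suc r) (v ↑ˡ suc m)
          ≡⟨ torsoV-vertex EG D′ (suc r) v ⟩
        (bag′ v == suc r)
          ≡⟨ ≡⇒== (trans (bag′-≢ (r≢t ∘ trans (sym v∈r))) (cong suc v∈r)) ⟩
        true ∎
        where
        open ≡-Reasoning
        v∈r : bag v ≡ r
        v∈r = torsoV-vertex⇒bag EG D x∈Z
      ... | node s = begin
        torsoV EG D′ (suc r) (image-other (n ↑ʳ s))
          ≡⟨ cong (torsoV EG D′ (suc r)) (mapNodes-node {n} _ s) ⟩
        torsoV EG D′ (suc r) (n ↑ʳ node′ s r)
          ≡⟨ torsoV-node EG D′ (suc r) (node′ s r) ⟩
        adjᵇ (lifted tedges) (suc r) (node′ s r)
          ≡⟨ adjᵇ-complete (lifted tedges) adj′ ⟩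
        true ∎
        where
        open ≡-Reasoning
        adj′ : Adj (lifted tedges) (suc r) (node′ s r)
        adj′ = subst (λ x → Adj (lifted tedges) x (node′ s r)) (node′-≢ s r≢t)
                 (there (Adj-edge′ (torsoV-node⇒Adj EG D x∈Z)))

      strength-other : ∀ {k} → suc k ≤ Δ (torso EG D r) → suc k ≤ Δ (torso EG D′ (suc r))
      strength-other r-strong with Δ-witness (torso EG D r) r-strong
      ... | x , x∈Z , x-large = ℕP.≤-trans x-large (ℕP.≤-trans
        (deg-≤-torso-map EG D D′ r (suc r) image-other x π-other image-other-injective)
        (deg≤Δ (torso EG D′ (suc r)) (image-other∈torso x∈Z)))

    split-tight : ∀ {k} → Tight EG D k → cutSize (torso EG D t) X ≤ k →
                  (∀ β → ∃ λ x → torsoV EG D t x ≡ true × X x ≡ β × suc k ≤ deg (torso EG D t) x) →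
                  Tight EG D′ k
    split-tight {k} (adh , strong) cut sides = adhesion′ adh cut , strength′
      where
      strength′ : StrengthAtLeast EG D′ (suc k)
      strength′ zero with sides false
      ... | _ , y∈Z , Xy , y-large = strength-half y∈Z Xy y-large
      strength′ (suc r) with r ≟ t
      ... | no r≢t   = strength-other r≢t (strong r)
      ... | yes refl with sides true
      ...   | _ , x∈Z , Xx , x-large = strength-half x∈Z Xx x-large

∑-indicator : ∀ {M} (y : Fin M) → sum (λ t → if y == t then 1 else 0) ≡ 1
∑-indicator {suc M} zero    = cong suc (sum-replicate-zero M)
∑-indicator {suc M} (suc y) = ∑-indicator y

∑-indicator-∧ : ∀ {M} (y : Fin M) b → sum (λ t → if (y == t) ∧ b then 1 else 0) ≡ (if b then 1 else 0)
∑-indicator-∧ y true =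
  trans (sum-cong-≗ (λ t → cong (if_then 1 else 0) (∧-identityʳ (y == t)))) (∑-indicator y)
∑-indicator-∧ {M} y false =
  trans (sum-cong-≗ (λ t → cong (if_then 1 else 0) (∧-zeroʳ (y == t)))) (sum-replicate-zero M)

∑-countᵇ : ∀ {A : Set} M (bg : A → Fin M) p xs →
           sum (λ t → countᵇ (λ v → (bg v == t) ∧ p v) xs) ≡ countᵇ p xs
∑-countᵇ M bg p []       = sum-replicate-zero M
∑-countᵇ {A} M bg p (x ∷ xs) = begin
  sum (λ t → countᵇ (q t) (x ∷ xs))
    ≡⟨ sum-cong-≗ (λ t → countᵇ-∷ (q t) x xs) ⟩
  sum (λ t → (if q t x then 1 else 0) ℕ.+ countᵇ (q t) xs)
    ≡⟨ ∑-distrib-+ (λ t → if q t x then 1 else 0) _ ⟩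
  sum (λ t → if q t x then 1 else 0) ℕ.+ sum (λ t → countᵇ (q t) xs)
    ≡⟨ cong₂ ℕ._+_ (∑-indicator-∧ (bg x) (p x)) (∑-countᵇ M bg p xs) ⟩
  (if p x then 1 else 0) ℕ.+ countᵇ p xs
    ≡⟨ countᵇ-∷ p x xs ⟨
  countᵇ p (x ∷ xs) ∎
  where
  open ≡-Reasoning
  q : Fin M → A → Bool
  q t v = (bg v == t) ∧ p v

foldr-tabulate-pred : ∀ M {K} (h : Fin M → Fin K) (a : Fin K → ℕ) →
  foldr (λ i r → (ℤ.+ a i ℤ.- ℤ.+ 1) ℤ.+ r) (ℤ.+ 0) (tabulate h) ≡ ℤ.+ sum (a ∘ h) ℤ.- ℤ.+ M
foldr-tabulate-pred zero    h a = refl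
foldr-tabulate-pred (suc M) h a = begin
  (ℤ.+ a₀ ℤ.- ℤ.+ 1) ℤ.+ foldr _ (ℤ.+ 0) (tabulate (h ∘ suc))
    ≡⟨ cong (λ r → (ℤ.+ a₀ ℤ.- ℤ.+ 1) ℤ.+ r) (foldr-tabulate-pred M (h ∘ suc) a) ⟩
  (ℤ.+ a₀ ℤ.- ℤ.+ 1) ℤ.+ (ℤ.+ S ℤ.- ℤ.+ M)
    ≡⟨ solve 3 (λ x y z → (x :- con (ℤ.+ 1)) :+ (y :- z) := (x :+ y) :- (con (ℤ.+ 1) :+ z))
             refl (ℤ.+ a₀) (ℤ.+ S) (ℤ.+ M) ⟩
  (ℤ.+ a₀ ℤ.+ ℤ.+ S) ℤ.- (ℤ.+ 1 ℤ.+ ℤ.+ M)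
    ≡⟨ cong₂ ℤ._-_ (ℤP.pos-+ a₀ S) (ℤP.pos-+ 1 M) ⟨
  ℤ.+ (a₀ ℕ.+ S) ℤ.- ℤ.+ suc M ∎
  where
  open ≡-Reasoning
  open +-*-Solver
  a₀ S : ℕ
  a₀ = a (h zero)
  S  = sum (a ∘ h ∘ suc)

w-formula : ∀ {n} (EG : List (Fin n × Fin n)) (D : TreePartition n) k →
  w EG D k ≡ ℤ.+ countᵇ (λ v → k ℕ.<ᵇ deg (asMGraph n EG) v) (allFin n) ℤ.- ℤ.+ TreePartition.m D
w-formula {n} EG D k = trans (foldr-tabulate-pred m (λ t → t) (sD EG D k))
  (cong (λ c → ℤ.+ c ℤ.- ℤ.+ m) (∑-countᵇ m bag _ (allFin n)))
  where open TreePartition D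

w-more-nodes : ∀ {n} (EG : List (Fin n × Fin n)) (D D′ : TreePartition n) k →
  TreePartition.m D′ ≡ suc (TreePartition.m D) → w EG D′ k < w EG D k
w-more-nodes EG D D′ k m′≡1+m rewrite w-formula EG D k | w-formula EG D′ k | m′≡1+m =
  ℤP.+-monoʳ-< (ℤ.+ _) (ℤP.neg-mono-< (ℤ.+<+ (ℕP.n<1+n (TreePartition.m D))))

lemma2 : (n : ℕ) (EG : List (Fin n × Fin n)) → Loopless EG → (k : ℕ)
       → (D : TreePartition n) → Tight EG D k
       → (∃ λ t → Splittable k (torso EG D t))
       → Σ (TreePartition n) λ D′ → Tight EG D′ k × (w EG D′ k < w EG D k)
lemma2 n EG _ k D tight (t , X , cut , (x , x∈Z , Xx , x-large) , (y , y∈Z , Xy , y-large)) =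
  D′ , split-tight EG tight cut sides , w-more-nodes EG D D′ k refl
  where
  open Split D t X
  sides : ∀ β → ∃ λ z → torsoV EG D t z ≡ true × X z ≡ β × suc k ≤ deg (torso EG D t) z
  sides true  = x , x∈Z , Xx , x-large
  sides false = y , y∈Z , Xy , y-large
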